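{- Let $P=(V,\leq)$ be a finite ordered set and let $x,y\in V$ be incomparable. Suppose that one of the following holds for $P$ or for its dual $P^*$: (i) there exists $z\in V$ such that $x<z$, $y$ is incomparable to both $x$ and $z$, and $\{x,y\}$ is autonomous in $P\setminus\{z\}$; (ii) there exist $z,t\in V$ such that $x<z$, $y<t$, $y$ is incomparable to $z$, $x$ is incomparable to $t$, and $\{x,y\}$ is autonomous in $P\setminus\{z,t\}$; (iii) there exist $z,t\in V$ such that $t<x<z$, $y$ is incomparable to both $t$ and $z$, and $\{x,y\}$ is autonomous in $P\setminus\{z,t\}$. Then $(x,y)$ is balanced in $P$, i.e. $\frac13\leq \mathbb{P}(x\prec y)\leq\frac23$.
   Context: $\mathbb{P}(x\prec y)$ denotes the proportion of linear extensions of $P$ that put $x$ before $y$. $P\setminus S$ denotes the suborder induced on $V\setminus S$. The dual $P^*$ is the order on $V$ with $x\leq y$ in $P^*$ iff $y\leq x$ in $P$. A subset $A$ of the ground set of an ordered set $R$ is autonomous in $R$ if for every element $v\notin A$ of $R$ and all $a,a'\in A$: ($v<a\Rightarrow v<a'$) and ($a<v\Rightarrow a'<v$). -}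

module Defs where

open import Data.Nat using (ℕ)
open import Data.Fin using (Fin; _≟_) renaming (_≤_ to _≤ꟳ_)
open import Data.Vec using (Vec; lookup; toList)
open import Data.List using (List; []; _∷_)
open import Data.Bool using (Bool; true; false)
open import Data.Product using (_×_; ∃)
open import Data.Sum using (_⊎_)
open import Relation.Nullary using (¬_; yes; no)
open import Relation.Binary.PropositionalEquality using (_≡_; _≢_)

-- A finite ordered set is P = (Fin n, _≤_) with _≤_ a (decidable) partial order.
-- All notions below are parametrised by the order relation R, so that the dual
-- is obtained by flipping R.

module _ {n : ℕ} (R : Fin n → Fin n → Set) where

  Lt : Fin n → Fin n → Set
  Lt a b = R a b × a ≢ b

  Incomp : Fin n → Fin n → Set
  Incomp a b = ¬ R a b × ¬ R b a

  AutonomousPair : (Removed : Fin n → Set) → Fin n → Fin n → Set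
  AutonomousPair Removed x y =
    ∀ v → ¬ Removed v → v ≢ x → v ≢ y →
      ((Lt v x → Lt v y) × (Lt v y → Lt v x)) ×
      ((Lt x v → Lt y v) × (Lt y v → Lt x v))

  CondI : Fin n → Fin n → Set
  CondI x y = ∃ λ z → Lt x z × Incomp y x × Incomp y z
                    × AutonomousPair (λ v → v ≡ z) x y

  CondII : Fin n → Fin n → Set
  CondII x y = ∃ λ z → ∃ λ t → Lt x z × Lt y t × Incomp y z × Incomp x t
                    × AutonomousPair (λ v → v ≡ z ⊎ v ≡ t) x y

  CondIII : Fin n → Fin n → Set
  CondIII x y = ∃ λ z → ∃ λ t → Lt t x × Lt x z × Incomp y t × Incomp y z
                    × AutonomousPair (λ v → v ≡ z ⊎ v ≡ t) x y

  Cond : Fin n → Fin n → Set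
  Cond x y = CondI x y ⊎ CondII x y ⊎ CondIII x y

  -- A linear extension, written as the sequence v₀ v₁ … v_{n-1} of the elements:
  -- every element occurs, and whenever vᵢ ≤ vⱼ in P we have i ≤ j
  -- (this also forces injectivity, by reflexivity of R).
  IsLinExt : Vec (Fin n) n → Set
  IsLinExt v = (∀ a → ∃ λ i → lookup v i ≡ a)
             × (∀ i j → R (lookup v i) (lookup v j) → i ≤ꟳ j)

Dual : {n : ℕ} → (Fin n → Fin n → Set) → Fin n → Fin n → Set
Dual R a b = R b a

firstIs : {n : ℕ} → Fin n → Fin n → List (Fin n) → Bool
firstIs x y [] = false
firstIs x y (a ∷ as) with a ≟ x
... | yes _ = true
... | no _ with a ≟ y
...   | yes _ = false
...   | no _ = firstIs x y as

before : {n : ℕ} → Fin n → Fin n → Vec (Fin n) n → Bool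
before x y v = firstIs x y (toList v)

-- Write #(a ≺ b) for the number of linear extensions putting a before b.  If
-- x < z, y ∥ x, y ∥ z, and every other element below y is below x and every
-- other element above x is above y, then an extension with x before y either
-- has z between them, and then the cyclic relabelling x ↦ y ↦ z ↦ x is again
-- an extension, or it has not, and then the transposition of x and y is.
-- Both maps are injective and land in extensions with y before x, so
-- #(x ≺ y) ≤ 2 #(y ≺ x).  Each of (i)–(iii) provides such a z; the reverse
-- inequality comes from (i) directly (z can never lie between y and x), from
-- (ii) with the roles of x and y exchanged, and from (iii) read in the dual.
-- Together with #(x ≺ y) + #(y ≺ x) = e(P) the two bounds give balance.
module Submission where

open import Defs
open import Data.Nat using (ℕ; suc; _+_; _*_; _≤_; z≤n; s≤s)
import Data.Nat.Properties as ℕ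
open import Data.Nat.Properties
  using ( ≤-trans; ≤-reflexive; +-suc; +-identityʳ; +-comm; *-distribˡ-+
        ; +-mono-≤; +-monoˡ-≤; +-monoʳ-≤; m≤m+n )
open import Data.Fin using (Fin; zero; suc; _≟_) renaming (_<_ to _<ᶠ_; _≤_ to _≤ᶠ_)
import Data.Fin.Properties as Fin
open import Data.Fin.Permutation
  using (Permutation′; transpose; _⟨$⟩ʳ_; _⟨$⟩ˡ_; _∘ₚ_; inverseˡ; inverseʳ)
open import Data.Vec using (Vec; _∷_; lookup; toList; map)
open import Data.Vec.Properties using (lookup-map; map-∘; map-cong; map-id)
open import Data.List using (List; []; _∷_; _++_; length; filter)
import Data.List as List
open import Data.List.Properties using (length-++; length-map)
open import Data.List.Membership.Propositional using (_∈_)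
open import Data.List.Membership.Propositional.Properties
  using (∈-∃++; ∈-++⁻; ∈-++⁺ˡ; ∈-++⁺ʳ; ∈-map⁻; ∈-filter⁻; ∈-filter⁺)
open import Data.List.Relation.Unary.Any using (here; there)
import Data.List.Relation.Unary.All as All
open import Data.List.Relation.Unary.Unique.Propositional using (Unique; _∷_)
import Data.List.Relation.Unary.Unique.Propositional.Properties as Unique
open import Data.Bool using (Bool; true; false; T; not; _∧_)
open import Data.Bool.Properties using (T?; T-∧)
open import Data.Empty using (⊥-elim)
open import Data.Product using (_×_; _,_; proj₁; proj₂; ∃; ∃₂; swap)
import Data.Product as Product
open import Data.Sum using (_⊎_; inj₁; inj₂; [_,_]; [_,_]′)
import Data.Sum as Sum
open import Function using (_∘_; flip; Equivalence)
open import Function.Definitions using (Injective)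
open import Relation.Binary using (IsPartialOrder; Decidable; Antisymmetric; tri<; tri≈; tri>)
import Relation.Binary.Construct.Flip.EqAndOrd as Flip
open import Relation.Binary.PropositionalEquality
  using (_≡_; _≢_; refl; sym; trans; cong; subst; subst₂; ≢-sym)
open import Relation.Nullary using (¬_; yes; no)
open import Relation.Nullary.Decidable using (dec-true; dec-false; decidable-stable)

-- Counting along lists

T-not⇒¬T : ∀ {b} → T (not b) → ¬ T b
T-not⇒¬T {false} _ ()

not-≡-of-exclusive : ∀ {p q} → (T p → ¬ T q) → (¬ T p → T q) → not p ≡ q
not-≡-of-exclusive {true}  {true}  not-both _       = ⊥-elim (not-both _ _)
not-≡-of-exclusive {true}  {false} _        _       = refl
not-≡-of-exclusive {false} {true}  _        _       = refl
not-≡-of-exclusive {false} {false} _        one-of  = ⊥-elim (one-of (λ ()))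

module _ {A : Set} where

  count : (A → Bool) → List A → ℕ
  count p xs = length (filter (T? ∘ p) xs)

  count-complement : ∀ p xs → length xs ≡ count p xs + count (not ∘ p) xs
  count-complement p [] = refl
  count-complement p (v ∷ vs) with p v
  ... | true  = cong suc (count-complement p vs)
  ... | false = trans (cong suc (count-complement p vs)) (sym (+-suc _ _))

  count-cong : ∀ {p q} xs → (∀ {v} → v ∈ xs → p v ≡ q v) → count p xs ≡ count q xs
  count-cong [] p≗q = refl
  count-cong {p} {q} (v ∷ vs) p≗q with p v | q v | p≗q (here refl)
  ... | true  | true  | _ = cong suc (count-cong vs (p≗q ∘ there))
  ... | false | false | _ = count-cong vs (p≗q ∘ there)

  count-≤-split : ∀ p c xs → count p xs ≤ count (λ v → p v ∧ not (c v)) xs + count c xs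
  count-≤-split p c [] = z≤n
  count-≤-split p c (v ∷ vs) with p v | c v | count-≤-split p c vs
  ... | true  | true  | ih = ≤-trans (s≤s ih) (≤-reflexive (sym (+-suc _ _)))
  ... | true  | false | ih = s≤s ih
  ... | false | true  | ih = ≤-trans ih (≤-trans (ℕ.n≤1+n _) (≤-reflexive (sym (+-suc _ _))))
  ... | false | false | ih = ih

  length-≤-of-unique-⊆ : (xs ys : List A) → Unique xs → (∀ {a} → a ∈ xs → a ∈ ys) →
                         length xs ≤ length ys
  length-≤-of-unique-⊆ [] ys _ _ = z≤n
  length-≤-of-unique-⊆ (x ∷ xs) ys (x∉xs ∷ unique) xs⊆ys with ∈-∃++ (xs⊆ys (here refl))
  ... | ys₁ , ys₂ , refl =
    ≤-trans (s≤s (length-≤-of-unique-⊆ xs (ys₁ ++ ys₂) unique xs⊆ys₁ys₂))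
            (≤-reflexive (sym (length-∷-middle ys₁)))
    where
      xs⊆ys₁ys₂ : ∀ {a} → a ∈ xs → a ∈ ys₁ ++ ys₂
      xs⊆ys₁ys₂ {a} a∈xs with ∈-++⁻ ys₁ (xs⊆ys (there a∈xs))
      ... | inj₁ a∈ys₁         = ∈-++⁺ˡ a∈ys₁
      ... | inj₂ (here refl)   = ⊥-elim (All.lookup x∉xs a∈xs refl)
      ... | inj₂ (there a∈ys₂) = ∈-++⁺ʳ ys₁ a∈ys₂

      length-∷-middle : ∀ zs → length (zs ++ x ∷ ys₂) ≡ suc (length (zs ++ ys₂))
      length-∷-middle zs =
        trans (length-++ zs) (trans (+-suc (length zs) _) (cong suc (sym (length-++ zs))))

  count-≤-injection : ∀ {p q} (xs : List A) → Unique xs → (f : A → A) → Injective _≡_ _≡_ f →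
    (∀ {v} → v ∈ xs → T (p v) → f v ∈ xs × T (q (f v))) → count p xs ≤ count q xs
  count-≤-injection {p} {q} xs unique f f-injective f-maps =
    ≤-trans (≤-reflexive (sym (length-map f (filter (T? ∘ p) xs))))
            (length-≤-of-unique-⊆ _ _ (Unique.map⁺ f-injective (Unique.filter⁺ (T? ∘ p) unique))
                                  image⊆)
    where
      image⊆ : ∀ {a} → a ∈ List.map f (filter (T? ∘ p) xs) → a ∈ filter (T? ∘ q) xs
      image⊆ a∈image with ∈-map⁻ f a∈image
      ... | v , v∈filter , refl with ∈-filter⁻ (T? ∘ p) v∈filter
      ... | v∈xs , pv = ∈-filter⁺ (T? ∘ q) (proj₁ (f-maps v∈xs pv)) (proj₂ (f-maps v∈xs pv))

-- Relabelling a linear extension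

record IsStrictLinearExtension {n : ℕ} (R _⊏_ : Fin n → Fin n → Set) : Set where
  field
    ⊏-asym      : ∀ {a b} → a ⊏ b → ¬ b ⊏ a
    ⊏-trans     : ∀ {a b c} → a ⊏ b → b ⊏ c → a ⊏ c
    ⊏-connected : ∀ {a b} → a ≢ b → a ⊏ b ⊎ b ⊏ a
    extends     : ∀ {a b} → R a b → a ≢ b → a ⊏ b

dual-extension : ∀ {n} {R _⊏_ : Fin n → Fin n → Set} →
  IsStrictLinearExtension R _⊏_ → IsStrictLinearExtension (Dual R) (flip _⊏_)
dual-extension L = record
  { ⊏-asym      = flip ⊏-asym
  ; ⊏-trans     = flip ⊏-trans
  ; ⊏-connected = Sum.swap ∘ ⊏-connected
  ; extends     = λ r a≢b → extends r (≢-sym a≢b)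
  }
  where open IsStrictLinearExtension L

-- An extension listing the elements in the order ⊏ remains an extension of R
-- after applying f to its entries exactly when this holds.
ExtendsRelabelled : ∀ {n} (R _⊏_ : Fin n → Fin n → Set) → (Fin n → Fin n) → Set
ExtendsRelabelled R _⊏_ f = ∀ {a b} → R (f a) (f b) → a ≢ b → a ⊏ b

module _ {n : ℕ} where

  transpose-matchˡ : (i j : Fin n) → transpose i j ⟨$⟩ʳ i ≡ j
  transpose-matchˡ i j rewrite dec-true (i ≟ i) refl = refl

  transpose-matchʳ : (i j : Fin n) → transpose i j ⟨$⟩ʳ j ≡ i
  transpose-matchʳ i j with i ≟ j
  ... | yes refl rewrite dec-true (i ≟ i) refl = refl
  ... | no i≢j rewrite dec-false (j ≟ i) (≢-sym i≢j) | dec-true (j ≟ j) refl = refl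

  transpose-fix : ∀ {i j k : Fin n} → k ≢ i → k ≢ j → transpose i j ⟨$⟩ʳ k ≡ k
  transpose-fix {i} {j} {k} k≢i k≢j rewrite dec-false (k ≟ i) k≢i | dec-false (k ≟ j) k≢j = refl

  rotation : Fin n → Fin n → Fin n → Permutation′ n
  rotation x y z = transpose y z ∘ₚ transpose x y

  rotation-x : ∀ {x y z} → x ≢ y → x ≢ z → rotation x y z ⟨$⟩ʳ x ≡ y
  rotation-x {x} {y} x≢y x≢z =
    trans (cong (transpose x y ⟨$⟩ʳ_) (transpose-fix x≢y x≢z)) (transpose-matchˡ x y)

  rotation-y : ∀ {x y z} → z ≢ x → z ≢ y → rotation x y z ⟨$⟩ʳ y ≡ z
  rotation-y {x} {y} {z} z≢x z≢y =
    trans (cong (transpose x y ⟨$⟩ʳ_) (transpose-matchˡ y z)) (transpose-fix z≢x z≢y)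

  rotation-z : ∀ x y z → rotation x y z ⟨$⟩ʳ z ≡ x
  rotation-z x y z = trans (cong (transpose x y ⟨$⟩ʳ_) (transpose-matchʳ y z)) (transpose-matchʳ x y)

  rotation-fix : ∀ {x y z w} → w ≢ x → w ≢ y → w ≢ z → rotation x y z ⟨$⟩ʳ w ≡ w
  rotation-fix {x} {y} w≢x w≢y w≢z =
    trans (cong (transpose x y ⟨$⟩ʳ_) (transpose-fix w≢y w≢z)) (transpose-fix w≢x w≢y)

  data Among (x y : Fin n) : Fin n → Set where
    is-x    : Among x y x
    is-y    : Among x y y
    neither : ∀ {a} → a ≢ x → a ≢ y → Among x y a

  among : ∀ x y a → Among x y a
  among x y a with a ≟ x | a ≟ y
  ... | yes refl | _        = is-x
  ... | no _     | yes refl = is-y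
  ... | no a≢x   | no a≢y   = neither a≢x a≢y

  data Among₃ (x y z : Fin n) : Fin n → Set where
    is-x    : Among₃ x y z x
    is-y    : Among₃ x y z y
    is-z    : Among₃ x y z z
    neither : ∀ {a} → a ≢ x → a ≢ y → a ≢ z → Among₃ x y z a

  among₃ : ∀ x y z a → Among₃ x y z a
  among₃ x y z a with among x y a | a ≟ z
  ... | is-x             | _        = is-x
  ... | is-y             | _        = is-y
  ... | neither _ _      | yes refl = is-z
  ... | neither a≢x a≢y  | no a≢z   = neither a≢x a≢y a≢z

module _ {n : ℕ} (R : Fin n → Fin n → Set) where

  -- x may overtake y in any extension that does not put z between them.
  Swappable : Fin n → Fin n → Fin n → Set
  Swappable x y z = Incomp R x y ×
    (∀ {w} → w ≢ x → w ≢ y → (Lt R w y → Lt R w x) × (Lt R x w → w ≡ z ⊎ Lt R y w))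

  HalfAutonomous : Fin n → Fin n → Fin n → Set
  HalfAutonomous x y z =
    ∀ {w} → w ≢ x → w ≢ y → w ≢ z → (Lt R w y → Lt R w x) × (Lt R x w → Lt R y w)

  Pivot : Fin n → Fin n → Fin n → Set
  Pivot x y z = Lt R x z × Incomp R x y × Incomp R y z × HalfAutonomous x y z

  incomp⇒≢ : (∀ {a} → R a a) → ∀ {a b} → Incomp R a b → a ≢ b
  incomp⇒≢ ≤-refl (a≰b , _) refl = a≰b ≤-refl

  pivot-swappable : ∀ {x y z} → Pivot x y z → Swappable x y z
  pivot-swappable {x} {y} {z} (_ , x∥y , (_ , z≰y) , half) = x∥y , swappable
    where
      swappable : ∀ {w} → w ≢ x → w ≢ y → (Lt R w y → Lt R w x) × (Lt R x w → w ≡ z ⊎ Lt R y w)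
      swappable {w} w≢x w≢y with w ≟ z
      ... | yes refl = (λ (z≤y , _) → ⊥-elim (z≰y z≤y)) , (λ _ → inj₁ refl)
      ... | no w≢z   = proj₁ (half w≢x w≢y w≢z) , inj₂ ∘ proj₂ (half w≢x w≢y w≢z)


module Relabelling {n : ℕ} {R _⊏_ : Fin n → Fin n → Set} (L : IsStrictLinearExtension R _⊏_) where
  open IsStrictLinearExtension L

  transposition-extends : ∀ {x y z} → Swappable R x y z → x ⊏ y → ¬ (x ⊏ z × z ⊏ y) →
    ExtendsRelabelled R _⊏_ (transpose x y ⟨$⟩ʳ_)
  transposition-extends {x} {y} {z} ((x≰y , y≰x) , swappable) x⊏y z∉x⊏y = τ-extends
    where
      τ-x : transpose x y ⟨$⟩ʳ x ≡ y
      τ-x = transpose-matchˡ x y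

      τ-y : transpose x y ⟨$⟩ʳ y ≡ x
      τ-y = transpose-matchʳ x y

      above-x : ∀ {w} → R x w → w ≢ x → w ≢ y → y ⊏ w
      above-x x≤w w≢x w≢y with proj₂ (swappable w≢x w≢y) (x≤w , ≢-sym w≢x)
      ... | inj₂ (y≤w , y≢w) = extends y≤w y≢w
      ... | inj₁ refl = [ (λ y⊏z → y⊏z) , (λ z⊏y → ⊥-elim (z∉x⊏y (extends x≤w (≢-sym w≢x) , z⊏y))) ]
                          (⊏-connected (≢-sym w≢y))

      τ-extends : ExtendsRelabelled R _⊏_ (transpose x y ⟨$⟩ʳ_)
      τ-extends {a} {b} r a≢b with among x y a | among x y b
      ... | is-x | is-x = ⊥-elim (a≢b refl)
      ... | is-x | is-y = ⊥-elim (y≰x (subst₂ R τ-x τ-y r))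
      ... | is-x | neither b≢x b≢y =
        ⊏-trans x⊏y (extends (subst₂ R τ-x (transpose-fix b≢x b≢y) r) (≢-sym b≢y))
      ... | is-y | is-x = ⊥-elim (x≰y (subst₂ R τ-y τ-x r))
      ... | is-y | is-y = ⊥-elim (a≢b refl)
      ... | is-y | neither b≢x b≢y = above-x (subst₂ R τ-y (transpose-fix b≢x b≢y) r) b≢x b≢y
      ... | neither a≢x a≢y | is-x =
        let (a≤x , _) = proj₁ (swappable a≢x a≢y) (subst₂ R (transpose-fix a≢x a≢y) τ-x r , a≢y)
        in extends a≤x a≢x
      ... | neither a≢x a≢y | is-y = ⊏-trans (extends (subst₂ R (transpose-fix a≢x a≢y) τ-y r) a≢x) x⊏y
      ... | neither a≢x a≢y | neither b≢x b≢y =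
        extends (subst₂ R (transpose-fix a≢x a≢y) (transpose-fix b≢x b≢y) r) a≢b

  rotation-extends : IsPartialOrder _≡_ R → ∀ {x y z} → Pivot R x y z → x ⊏ z → z ⊏ y →
    ExtendsRelabelled R _⊏_ (rotation x y z ⟨$⟩ʳ_)
  rotation-extends po {x} {y} {z} ((x≤z , x≢z) , (x≰y , y≰x) , (y≰z , z≰y) , half) x⊏z z⊏y = ρ-extends
    where
      open IsPartialOrder po using (antisym) renaming (refl to ≤-refl; trans to ≤-trans′)

      ρ-x : rotation x y z ⟨$⟩ʳ x ≡ y
      ρ-x = rotation-x (incomp⇒≢ R ≤-refl (x≰y , y≰x)) x≢z

      ρ-y : rotation x y z ⟨$⟩ʳ y ≡ z
      ρ-y = rotation-y (≢-sym x≢z) (incomp⇒≢ R ≤-refl (z≰y , y≰z))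

      ρ-z : rotation x y z ⟨$⟩ʳ z ≡ x
      ρ-z = rotation-z x y z

      ρ-extends : ExtendsRelabelled R _⊏_ (rotation x y z ⟨$⟩ʳ_)
      ρ-extends {a} {b} r a≢b with among₃ x y z a | among₃ x y z b
      ... | is-x | is-x = ⊥-elim (a≢b refl)
      ... | is-x | is-y = ⊥-elim (y≰z (subst₂ R ρ-x ρ-y r))
      ... | is-x | is-z = ⊥-elim (y≰x (subst₂ R ρ-x ρ-z r))
      ... | is-x | neither b≢x b≢y b≢z =
        ⊏-trans (⊏-trans x⊏z z⊏y) (extends (subst₂ R ρ-x (rotation-fix b≢x b≢y b≢z) r) (≢-sym b≢y))
      ... | is-y | is-x = ⊥-elim (z≰y (subst₂ R ρ-y ρ-x r))
      ... | is-y | is-y = ⊥-elim (a≢b refl)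
      ... | is-y | is-z = ⊥-elim (x≢z (antisym x≤z (subst₂ R ρ-y ρ-z r)))
      ... | is-y | neither b≢x b≢y b≢z =
        let z≤b = subst₂ R ρ-y (rotation-fix b≢x b≢y b≢z) r
            (y≤b , y≢b) = proj₂ (half b≢x b≢y b≢z) (≤-trans′ x≤z z≤b , ≢-sym b≢x)
        in extends y≤b y≢b
      ... | is-z | is-x = ⊥-elim (x≰y (subst₂ R ρ-z ρ-x r))
      ... | is-z | is-y = z⊏y
      ... | is-z | is-z = ⊥-elim (a≢b refl)
      ... | is-z | neither b≢x b≢y b≢z =
        let x≤b = subst₂ R ρ-z (rotation-fix b≢x b≢y b≢z) r
            (y≤b , y≢b) = proj₂ (half b≢x b≢y b≢z) (x≤b , ≢-sym b≢x)
        in ⊏-trans z⊏y (extends y≤b y≢b)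
      ... | neither a≢x a≢y a≢z | is-x =
        let (a≤x , _) = proj₁ (half a≢x a≢y a≢z) (subst₂ R (rotation-fix a≢x a≢y a≢z) ρ-x r , a≢y)
        in extends a≤x a≢x
      ... | neither a≢x a≢y a≢z | is-y =
        ⊏-trans (extends (subst₂ R (rotation-fix a≢x a≢y a≢z) ρ-y r) a≢z) z⊏y
      ... | neither a≢x a≢y a≢z | is-z =
        ⊏-trans (extends (subst₂ R (rotation-fix a≢x a≢y a≢z) ρ-z r) a≢x) x⊏z
      ... | neither a≢x a≢y a≢z | neither b≢x b≢y b≢z =
        extends (subst₂ R (rotation-fix a≢x a≢y a≢z) (rotation-fix b≢x b≢y b≢z) r) a≢b

-- From the hypotheses (i)–(iii) to pivots

module _ {n : ℕ} {R : Fin n → Fin n → Set} where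

  autonomous-⊆ : ∀ {S S′ : Fin n → Set} {x y} → (∀ {v} → S v → S′ v) →
                 AutonomousPair R S x y → AutonomousPair R S′ x y
  autonomous-⊆ S⊆S′ aut v v∉S′ = aut v (v∉S′ ∘ S⊆S′)

  autonomous-sym : ∀ {S x y} → AutonomousPair R S x y → AutonomousPair R S y x
  autonomous-sym aut v v∉S v≢y v≢x = Product.map swap swap (aut v v∉S v≢x v≢y)

  autonomous-dual : ∀ {S x y} → AutonomousPair R S x y → AutonomousPair (Dual R) S x y
  autonomous-dual aut v v∉S v≢x v≢y =
    let ((vx⇒vy , vy⇒vx) , (xv⇒yv , yv⇒xv)) = aut v v∉S v≢x v≢y
    in (flipped xv⇒yv , flipped yv⇒xv) , (flipped vx⇒vy , flipped vy⇒vx)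
    where
      flipped : ∀ {a b c d} → (Lt R a b → Lt R c d) → Lt (Dual R) b a → Lt (Dual R) d c
      flipped f = Product.map₂ ≢-sym ∘ f ∘ Product.map₂ ≢-sym

  half-autonomous₁ : ∀ {x y z} → AutonomousPair R (_≡ z) x y → HalfAutonomous R x y z
  half-autonomous₁ aut w≢x w≢y w≢z = let ((_ , vy⇒vx) , (xv⇒yv , _)) = aut _ w≢z w≢x w≢y in vy⇒vx , xv⇒yv

  half-autonomous₂ : ∀ {x y z t} → AutonomousPair R (λ v → v ≡ z ⊎ v ≡ t) x y →
                     ¬ Lt R t y → ¬ Lt R x t → HalfAutonomous R x y z
  half-autonomous₂ {t = t} aut t≮y x≮t {w} w≢x w≢y w≢z with w ≟ t
  ... | yes refl = ⊥-elim ∘ t≮y , ⊥-elim ∘ x≮t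
  ... | no w≢t   = let ((_ , vy⇒vx) , (xv⇒yv , _)) = aut w [ w≢z , w≢t ] w≢x w≢y in vy⇒vx , xv⇒yv

  module _ (antisym : Antisymmetric _≡_ R) where

    swappable-of-condI : ∀ {x y z} → Lt R x z → Incomp R y x → AutonomousPair R (_≡ z) x y →
                         Swappable R y x z
    swappable-of-condI {x} {y} {z} (x≤z , x≢z) y∥x aut = y∥x , swappable
      where
        swappable : ∀ {w} → w ≢ y → w ≢ x → (Lt R w x → Lt R w y) × (Lt R y w → w ≡ z ⊎ Lt R x w)
        swappable {w} w≢y w≢x with w ≟ z
        ... | yes refl = (λ (z≤x , _) → ⊥-elim (x≢z (antisym x≤z z≤x))) , (λ _ → inj₁ refl)
        ... | no w≢z   = let ((vx⇒vy , _) , (_ , yv⇒xv)) = aut w w≢z w≢x w≢y in vx⇒vy , inj₂ ∘ yv⇒xv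

    condI-pivot : ∀ {x y} → Incomp R x y → CondI R x y → ∃ (Pivot R x y)
    condI-pivot x∥y (z , x<z , _ , y∥z , aut) = z , x<z , x∥y , y∥z , half-autonomous₁ aut

    condII-pivot : ∀ {x y} → Incomp R x y → CondII R x y → ∃ (Pivot R x y)
    condII-pivot x∥y (z , t , x<z , (y≤t , y≢t) , y∥z , (x≰t , _) , aut) =
      z , x<z , x∥y , y∥z ,
      half-autonomous₂ aut (λ (t≤y , _) → y≢t (antisym y≤t t≤y)) (λ (x≤t , _) → x≰t x≤t)

    condIII-pivot : ∀ {x y} → Incomp R x y → CondIII R x y → ∃ (Pivot R x y)
    condIII-pivot x∥y (z , t , (t≤x , t≢x) , x<z , (_ , t≰y) , y∥z , aut) =
      z , x<z , x∥y , y∥z ,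
      half-autonomous₂ aut (λ (t≤y , _) → t≰y t≤y) (λ (x≤t , _) → t≢x (antisym t≤x x≤t))

    cond-pivot : ∀ {x y} → Incomp R x y → Cond R x y → ∃ (Pivot R x y)
    cond-pivot x∥y = [ condI-pivot x∥y , [ condII-pivot x∥y , condIII-pivot x∥y ] ]

  condII-sym : ∀ {x y} → CondII R x y → CondII R y x
  condII-sym (z , t , x<z , y<t , y∥z , x∥t , aut) =
    t , z , y<t , x<z , x∥t , y∥z , autonomous-⊆ Sum.swap (autonomous-sym aut)

-- In the dual, the roles of the lower witness t and the upper witness z are exchanged.
condIII-dual : ∀ {n} {R : Fin n → Fin n → Set} {x y} → CondIII R x y → CondIII (Dual R) x y
condIII-dual {R = R} (z , t , t<x , x<z , y∥t , y∥z , aut) =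
  t , z , Product.map₂ ≢-sym x<z , Product.map₂ ≢-sym t<x , swap y∥z , swap y∥t ,
  autonomous-⊆ {R = Dual R} Sum.swap (autonomous-dual aut)

-- Counting linear extensions

-- Kept abstract so that the dual order can reuse the same list, each extension read backwards.
record LinearExtensions {n : ℕ} (R : Fin n → Fin n → Set) : Set₁ where
  field
    Ext               : Set
    extensions        : List Ext
    unique            : Unique extensions
    _⊏[_]_            : Fin n → Ext → Fin n → Set
    precedes          : Fin n → Fin n → Ext → Bool
    relabel           : Permutation′ n → Ext → Ext
    linear            : ∀ {v} → v ∈ extensions → IsStrictLinearExtension R (_⊏[ v ]_)
    precedes-sound    : ∀ {v a b} → v ∈ extensions → a ≢ b → T (precedes a b v) → a ⊏[ v ] b
    precedes-complete : ∀ {v a b} → v ∈ extensions → a ⊏[ v ] b → T (precedes a b v)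
    relabel-injective : ∀ π → Injective _≡_ _≡_ (relabel π)
    relabel-order     : ∀ π {v a b} → a ⊏[ v ] b → (π ⟨$⟩ʳ a) ⊏[ relabel π v ] (π ⟨$⟩ʳ b)
    relabel-closed    : ∀ π {v} → v ∈ extensions → ExtendsRelabelled R (_⊏[ v ]_) (π ⟨$⟩ʳ_) →
                        relabel π v ∈ extensions

dual : ∀ {n} {R : Fin n → Fin n → Set} → LinearExtensions R → LinearExtensions (Dual R)
dual E = record
  { Ext               = Ext
  ; extensions        = extensions
  ; unique            = unique
  ; _⊏[_]_            = λ a v b → b ⊏[ v ] a
  ; precedes          = flip precedes
  ; relabel           = relabel
  ; linear            = dual-extension ∘ linear
  ; precedes-sound    = λ v∈ a≢b → precedes-sound v∈ (≢-sym a≢b)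
  ; precedes-complete = precedes-complete
  ; relabel-injective = relabel-injective
  ; relabel-order     = λ π b⊏a → relabel-order π b⊏a
  ; relabel-closed    = λ π v∈ extends → relabel-closed π v∈ (λ r a≢b → extends r (≢-sym a≢b))
  }
  where open LinearExtensions E

module Counting {n : ℕ} {R : Fin n → Fin n → Set} (po : IsPartialOrder _≡_ R) (E : LinearExtensions R) where
  open LinearExtensions E public
  open IsPartialOrder po using () renaming (refl to ≤-refl)

  module Linear {v} (v∈ : v ∈ extensions) = IsStrictLinearExtension (linear v∈)

  #_ : (Ext → Bool) → ℕ
  # p = count p extensions

  between : Fin n → Fin n → Fin n → Ext → Bool
  between x z y v = precedes x z v ∧ precedes z y v

  precedes-complement : ∀ {a b} → a ≢ b → length extensions ≡ # precedes a b + # precedes b a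
  precedes-complement {a} {b} a≢b =
    trans (count-complement (precedes a b) extensions)
          (cong (# precedes a b +_) (count-cong extensions flipped))
    where
      flipped : ∀ {v} → v ∈ extensions → not (precedes a b v) ≡ precedes b a v
      flipped v∈ = not-≡-of-exclusive
        (λ ab ba → Linear.⊏-asym v∈ (precedes-sound v∈ a≢b ab) (precedes-sound v∈ (≢-sym a≢b) ba))
        (λ ¬ab → [ ⊥-elim ∘ ¬ab ∘ precedes-complete v∈ , precedes-complete v∈ ]
                   (Linear.⊏-connected v∈ a≢b))

  relabel-count : ∀ π {p a b} →
    (∀ {v} → v ∈ extensions → T (p v) → ExtendsRelabelled R (_⊏[ v ]_) (π ⟨$⟩ʳ_) × a ⊏[ v ] b) →
    # p ≤ # precedes (π ⟨$⟩ʳ a) (π ⟨$⟩ʳ b)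
  relabel-count π {p} {a} {b} relabels =
    count-≤-injection extensions unique (relabel π) (relabel-injective π) maps
    where
      maps : ∀ {v} → v ∈ extensions → T (p v) →
             relabel π v ∈ extensions × T (precedes (π ⟨$⟩ʳ a) (π ⟨$⟩ʳ b) (relabel π v))
      maps v∈ pv = let (π-extends , a⊏b) = relabels v∈ pv
                       πv∈ = relabel-closed π v∈ π-extends
                   in πv∈ , precedes-complete πv∈ (relabel-order π a⊏b)

  transposition-count : ∀ {x y z p} → Swappable R x y z →
    (∀ {v} → v ∈ extensions → T (p v) → x ⊏[ v ] y × ¬ (x ⊏[ v ] z × z ⊏[ v ] y)) →
    # p ≤ # precedes y x
  transposition-count {x} {y} {p = p} swappable separated =
    subst₂ (λ a b → # p ≤ # precedes a b) (transpose-matchˡ x y) (transpose-matchʳ x y)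
      (relabel-count (transpose x y) λ v∈ pv →
         let (x⊏y , z∉x⊏y) = separated v∈ pv
         in Relabelling.transposition-extends (linear v∈) swappable x⊏y z∉x⊏y , x⊏y)

  rotation-count : ∀ {x y z} → Pivot R x y z → # between x z y ≤ # precedes y x
  rotation-count {x} {y} {z} pivot@((_ , x≢z) , x∥y , y∥z , _) =
    subst₂ (λ a b → # between x z y ≤ # precedes a b)
      (rotation-x (incomp⇒≢ R ≤-refl x∥y) x≢z) (rotation-z x y z)
      (relabel-count (rotation x y z) λ v∈ xzy →
         let (xz , zy) = Equivalence.to T-∧ xzy
             x⊏z = precedes-sound v∈ x≢z xz
             z⊏y = precedes-sound v∈ (≢-sym (incomp⇒≢ R ≤-refl y∥z)) zy
         in Relabelling.rotation-extends (linear v∈) po pivot x⊏z z⊏y , x⊏z)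

  at-most-twice : ∀ {x y z} → Pivot R x y z → # precedes x y ≤ 2 * # precedes y x
  at-most-twice {x} {y} {z} pivot@(_ , x∥y , _) = begin
    # precedes x y                          ≤⟨ count-≤-split _ _ extensions ⟩
    # z-outside + # between x z y           ≤⟨ +-mono-≤ swapped (rotation-count pivot) ⟩
    # precedes y x + # precedes y x         ≡⟨ cong (# precedes y x +_) (sym (+-identityʳ _)) ⟩
    2 * # precedes y x                      ∎
    where
      open ℕ.≤-Reasoning

      z-outside : Ext → Bool
      z-outside v = precedes x y v ∧ not (between x z y v)

      swapped : # z-outside ≤ # precedes y x
      swapped = transposition-count (pivot-swappable R pivot) λ v∈ t →
        let (xy , not-between) = Equivalence.to T-∧ t
        in precedes-sound v∈ (incomp⇒≢ R ≤-refl x∥y) xy ,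
           λ (x⊏z , z⊏y) → T-not⇒¬T not-between
                             (Equivalence.from T-∧ (precedes-complete v∈ x⊏z , precedes-complete v∈ z⊏y))

  at-most-once : ∀ {x y z} → Lt R x z → Swappable R y x z → # precedes y x ≤ # precedes x y
  at-most-once (x≤z , x≢z) swappable@(y∥x , _) = transposition-count swappable λ v∈ yx →
    precedes-sound v∈ (incomp⇒≢ R ≤-refl y∥x) yx ,
    λ (_ , z⊏x) → Linear.⊏-asym v∈ z⊏x (Linear.extends v∈ x≤z x≢z)

-- Linear extensions listed as vectors

module _ {n : ℕ} where

  OccursBefore : ∀ {m} → Vec (Fin n) m → Fin n → Fin n → Set
  OccursBefore v a b = ∃₂ λ i j → lookup v i ≡ a × lookup v j ≡ b × i <ᶠ j

  firstIs-true : ∀ {m} (v : Vec (Fin n) m) {a b} (j : Fin m) → a ≢ b → lookup v j ≡ b →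
                 T (firstIs a b (toList v)) → ∃ λ i → i <ᶠ j × lookup v i ≡ a
  firstIs-true (c ∷ v) {a} {b} zero a≢b c≡b t with c ≟ a
  ... | yes c≡a = ⊥-elim (a≢b (trans (sym c≡a) c≡b))
  ... | no _ with c ≟ b
  ...   | yes _   = ⊥-elim t
  ...   | no c≢b  = ⊥-elim (c≢b c≡b)
  firstIs-true (c ∷ v) {a} {b} (suc j) a≢b vj≡b t with c ≟ a
  ... | yes c≡a = zero , s≤s z≤n , c≡a
  ... | no _ with c ≟ b
  ...   | yes _ = ⊥-elim t
  ...   | no _ with firstIs-true v j a≢b vj≡b t
  ...     | i , i<j , vi≡a = suc i , s≤s i<j , vi≡a

  firstIs-false : ∀ {m} (v : Vec (Fin n) m) {a b} (i : Fin m) → lookup v i ≡ a →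
                  ¬ T (firstIs a b (toList v)) → ∃ λ j → j <ᶠ i × lookup v j ≡ b
  firstIs-false (c ∷ v) {a} {b} zero c≡a ¬t with c ≟ a
  ... | yes _   = ⊥-elim (¬t _)
  ... | no c≢a  = ⊥-elim (c≢a c≡a)
  firstIs-false (c ∷ v) {a} {b} (suc i) vi≡a ¬t with c ≟ a
  ... | yes _ = ⊥-elim (¬t _)
  ... | no _ with c ≟ b
  ...   | yes c≡b = zero , s≤s z≤n , c≡b
  ...   | no _ with firstIs-false v i vi≡a ¬t
  ...     | j , j<i , vj≡b = suc j , s≤s j<i , vj≡b

  occursBefore-map : ∀ {m} (f : Fin n → Fin n) (v : Vec (Fin n) m) {a b} →
                     OccursBefore v a b → OccursBefore (map f v) (f a) (f b)
  occursBefore-map f v (i , j , vi≡a , vj≡b , i<j) =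
    i , j , trans (lookup-map i f v) (cong f vi≡a) , trans (lookup-map j f v) (cong f vj≡b) , i<j

  map-permutation-injective : ∀ {m} (π : Permutation′ n) → Injective _≡_ _≡_ (map {n = m} (π ⟨$⟩ʳ_))
  map-permutation-injective π {v} {w} πv≡πw =
    trans (sym (unpermute v)) (trans (cong (map (π ⟨$⟩ˡ_)) πv≡πw) (unpermute w))
    where
      unpermute : ∀ u → map (π ⟨$⟩ˡ_) (map (π ⟨$⟩ʳ_) u) ≡ u
      unpermute u = trans (sym (map-∘ _ _ u)) (trans (map-cong (λ _ → inverseˡ π) u) (map-id u))

module VectorExtensions {n : ℕ} {R : Fin n → Fin n → Set} (po : IsPartialOrder _≡_ R) where
  open IsPartialOrder po using () renaming (refl to ≤-refl)

  module _ {v : Vec (Fin n) n} (v-extends : IsLinExt R v) where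
    private
      v-onto = proj₁ v-extends
      v-monotone = proj₂ v-extends

    lookup-injective : Injective _≡_ _≡_ (lookup v)
    lookup-injective {i} {j} vi≡vj =
      Fin.≤-antisym (v-monotone i j (subst (R _) vi≡vj ≤-refl))
                    (v-monotone j i (subst (flip R _) vi≡vj ≤-refl))

    occursBefore-linear : IsStrictLinearExtension R (OccursBefore v)
    occursBefore-linear = record
      { ⊏-asym = asym ; ⊏-trans = trans′ ; ⊏-connected = connected ; extends = extends }
      where
        asym : ∀ {a b} → OccursBefore v a b → ¬ OccursBefore v b a
        asym (i , j , vi≡a , vj≡b , i<j) (j′ , i′ , vj′≡b , vi′≡a , j′<i′)
          with lookup-injective (trans vi≡a (sym vi′≡a)) | lookup-injective (trans vj≡b (sym vj′≡b))
        ... | refl | refl = Fin.<-asym i<j j′<i′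

        trans′ : ∀ {a b c} → OccursBefore v a b → OccursBefore v b c → OccursBefore v a c
        trans′ (i , j , vi≡a , vj≡b , i<j) (j′ , k , vj′≡b , vk≡c , j′<k)
          with lookup-injective (trans vj≡b (sym vj′≡b))
        ... | refl = i , k , vi≡a , vk≡c , Fin.<-trans i<j j′<k

        connected : ∀ {a b} → a ≢ b → OccursBefore v a b ⊎ OccursBefore v b a
        connected {a} {b} a≢b with v-onto a | v-onto b
        ... | i , vi≡a | j , vj≡b with Fin.<-cmp i j
        ... | tri< i<j _ _ = inj₁ (i , j , vi≡a , vj≡b , i<j)
        ... | tri≈ _ refl _ = ⊥-elim (a≢b (trans (sym vi≡a) vj≡b))
        ... | tri> _ _ j<i = inj₂ (j , i , vj≡b , vi≡a , j<i)

        extends : ∀ {a b} → R a b → a ≢ b → OccursBefore v a b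
        extends {a} {b} a≤b a≢b with v-onto a | v-onto b
        ... | i , refl | j , refl with Fin.<-cmp i j
        ... | tri< i<j _ _ = i , j , refl , refl , i<j
        ... | tri≈ _ refl _ = ⊥-elim (a≢b refl)
        ... | tri> _ _ j<i = ⊥-elim (ℕ.<⇒≱ j<i (v-monotone i j a≤b))

    before-sound : ∀ {a b} → a ≢ b → T (before a b v) → OccursBefore v a b
    before-sound {a} {b} a≢b t with v-onto b
    ... | j , vj≡b with firstIs-true v j a≢b vj≡b t
    ... | i , i<j , vi≡a = i , j , vi≡a , vj≡b , i<j

    before-complete : ∀ {a b} → OccursBefore v a b → T (before a b v)
    before-complete {a} {b} a⊏b = decidable-stable (T? _) λ ¬t →
      let (i , vi≡a) = v-onto a
          (j , j<i , vj≡b) = firstIs-false v i vi≡a ¬t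
      in IsStrictLinearExtension.⊏-asym occursBefore-linear a⊏b (j , i , vj≡b , vi≡a , j<i)

    relabelled-extends : (π : Permutation′ n) → ExtendsRelabelled R (OccursBefore v) (π ⟨$⟩ʳ_) →
                         IsLinExt R (map (π ⟨$⟩ʳ_) v)
    relabelled-extends π π-extends = onto , monotone
      where
        onto : ∀ a → ∃ λ i → lookup (map (π ⟨$⟩ʳ_) v) i ≡ a
        onto a = let (i , vi≡a) = v-onto (π ⟨$⟩ˡ a)
                 in i , trans (lookup-map i _ v) (trans (cong (π ⟨$⟩ʳ_) vi≡a) (inverseʳ π))

        monotone : ∀ i j → R (lookup (map (π ⟨$⟩ʳ_) v) i) (lookup (map (π ⟨$⟩ʳ_) v) j) → i ≤ᶠ j
        monotone i j r with lookup v i ≟ lookup v j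
        ... | yes vi≡vj = Fin.≤-reflexive (lookup-injective vi≡vj)
        ... | no vi≢vj with π-extends (subst₂ R (lookup-map i _ v) (lookup-map j _ v) r) vi≢vj
        ...   | i′ , j′ , vi′≡vi , vj′≡vj , i′<j′ with lookup-injective vi′≡vi | lookup-injective vj′≡vj
        ...     | refl | refl = ℕ.<⇒≤ i′<j′

  vectorExtensions : (Es : List (Vec (Fin n) n)) → Unique Es →
    (∀ v → (IsLinExt R v → v ∈ Es) × (v ∈ Es → IsLinExt R v)) → LinearExtensions R
  vectorExtensions Es unique enumerates = record
    { Ext               = Vec (Fin n) n
    ; extensions        = Es
    ; unique            = unique
    ; _⊏[_]_            = λ a v b → OccursBefore v a b
    ; precedes          = before
    ; relabel           = λ π → map (π ⟨$⟩ʳ_)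
    ; linear            = λ {v} v∈ → occursBefore-linear {v} (extends v∈)
    ; precedes-sound    = λ {v} v∈ → before-sound {v} (extends v∈)
    ; precedes-complete = λ {v} v∈ → before-complete {v} (extends v∈)
    ; relabel-injective = map-permutation-injective
    ; relabel-order     = λ π {v} → occursBefore-map (π ⟨$⟩ʳ_) v
    ; relabel-closed    = λ π {v} v∈ π-extends →
                            proj₁ (enumerates _) (relabelled-extends {v} (extends v∈) π π-extends)
    }
    where
      extends : ∀ {v} → v ∈ Es → IsLinExt R v
      extends {v} = proj₂ (enumerates v)

ratio-bounds : ∀ {n} {R : Fin n → Fin n → Set} (po : IsPartialOrder _≡_ R) (E : LinearExtensions R) {x y} →
  Incomp R x y → Cond R x y →
  let open Counting po E in (# precedes x y ≤ 2 * # precedes y x) × (# precedes y x ≤ 2 * # precedes x y)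
ratio-bounds {R = R} po E {x} {y} x∥y cond =
  at-most-twice (proj₂ (cond-pivot antisym x∥y cond)) , reverse cond
  where
    open Counting po E
    open IsPartialOrder po using (antisym)

    reverse : Cond R x y → # precedes y x ≤ 2 * # precedes x y
    reverse (inj₁ (z , x<z , y∥x , _ , aut)) =
      ≤-trans (at-most-once x<z (swappable-of-condI antisym x<z y∥x aut)) (m≤m+n _ _)
    reverse (inj₂ (inj₁ c)) = at-most-twice (proj₂ (condII-pivot antisym (swap x∥y) (condII-sym c)))
    reverse (inj₂ (inj₂ c)) = Counting.at-most-twice (Flip.isPartialOrder po) (dual E)
      (proj₂ (condIII-pivot (λ y≥x x≥y → antisym x≥y y≥x) (swap x∥y) (condIII-dual c)))

balanced-thirds : ∀ {N A B} → N ≡ A + B → A ≤ 2 * B → B ≤ 2 * A → (N ≤ 3 * A) × (3 * A ≤ 2 * N)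
balanced-thirds {A = A} {B} refl A≤2B B≤2A = +-monoʳ-≤ A B≤2A , (begin
  A + 2 * A      ≤⟨ +-monoˡ-≤ (2 * A) A≤2B ⟩
  2 * B + 2 * A  ≡⟨ +-comm (2 * B) (2 * A) ⟩
  2 * A + 2 * B  ≡⟨ *-distribˡ-+ 2 A B ⟨
  2 * (A + B)    ∎)
  where open ℕ.≤-Reasoning

theorem2 : (n : ℕ) (_≼_ : Fin n → Fin n → Set) → IsPartialOrder _≡_ _≼_ → Decidable _≼_ →
    (x y : Fin n) → Incomp _≼_ x y →
    Cond _≼_ x y ⊎ Cond (Dual _≼_) x y →
    (Es : List (Vec (Fin n) n)) → Unique Es →
    (∀ v → (IsLinExt _≼_ v → v ∈ Es) × (v ∈ Es → IsLinExt _≼_ v)) →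
    let k = length (filter (λ v → T? (before x y v)) Es) in
    (length Es ≤ 3 * k) × (3 * k ≤ 2 * length Es)
theorem2 n _≼_ po _ x y x∥y cond Es unique enumerates =
  balanced-thirds (precedes-complement (incomp⇒≢ _≼_ ≤-refl x∥y)) (proj₁ ratios) (proj₂ ratios)
  where
    E = VectorExtensions.vectorExtensions po Es unique enumerates
    open Counting po E
    open IsPartialOrder po using () renaming (refl to ≤-refl)

    ratios : (# precedes x y ≤ 2 * # precedes y x) × (# precedes y x ≤ 2 * # precedes x y)
    ratios = [ ratio-bounds po E x∥y
             , swap ∘ ratio-bounds (Flip.isPartialOrder po) (dual E) (swap x∥y)
             ]′ cond
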